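{- Let $q$ be a prime power, let $n$ be a positive integer with $\gcd(n,q-1)=1$, and let $h(x)\in\mathbb{F}_q[x]$. Write $\mathrm{N}(x)=x^{(q^n-1)/(q-1)}$ for the norm map from $\mathbb{F}_{q^n}$ to $\mathbb{F}_q$. Then $x\,h(\mathrm{N}(x))$ is a complete permutation polynomial of $\mathbb{F}_{q^n}$ if and only if $x\,h(x^n)$ is a complete permutation polynomial of $\mathbb{F}_q$.
   Context: A polynomial $f(x)\in\mathbb{F}_Q[x]$ is a permutation polynomial of $\mathbb{F}_Q$ if the map $\alpha\mapsto f(\alpha)$ is a bijection of $\mathbb{F}_Q$. It is a complete permutation polynomial of $\mathbb{F}_Q$ if both $f(x)$ and $f(x)+x$ are permutation polynomials of $\mathbb{F}_Q$. -}

module Defs where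

open import Level using (0ℓ)
open import Data.Nat using (ℕ; zero; suc)
open import Data.Fin using (Fin)
open import Data.List using (List; []; _∷_; map)
open import Data.Product using (∃; _×_)
open import Relation.Nullary using (¬_)
open import Relation.Binary.PropositionalEquality using (_≡_)
open import Algebra.Structures using (IsCommutativeRing)
open import Function.Bundles using (_↔_)
open import Function.Definitions using (Bijective; Injective)

record FiniteField : Set₁ where
  infixl 7 _*_
  infixl 6 _+_
  field
    Carrier : Set
    _+_ _*_ : Carrier → Carrier → Carrier
    -_      : Carrier → Carrier
    0# 1#   : Carrier
    isCommutativeRing : IsCommutativeRing _≡_ _+_ _*_ -_ 0# 1#
    0≢1     : ¬ (0# ≡ 1#)
    inverse : ∀ x → ¬ (x ≡ 0#) → ∃ λ y → x * y ≡ 1#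
    size    : ℕ
    enum    : Fin size ↔ Carrier

  _^_ : Carrier → ℕ → Carrier
  x ^ zero  = 1#
  x ^ suc k = x * (x ^ k)

  -- polynomials: coefficient lists, lowest degree first; Horner evaluation
  Poly : Set
  Poly = List Carrier

  eval : Poly → Carrier → Carrier
  eval []       x = 0#
  eval (c ∷ cs) x = c + x * eval cs x

open FiniteField

IsPermutation : (F : FiniteField) → (Carrier F → Carrier F) → Set
IsPermutation F f = Bijective _≡_ _≡_ f

IsCompletePermutation : (F : FiniteField) → (Carrier F → Carrier F) → Set
IsCompletePermutation F f =
  IsPermutation F f × IsPermutation F (λ x → _+_ F (f x) x)

record FieldEmbedding (K L : FiniteField) : Set where
  field
    ι      : Carrier K → Carrier L
    ι-+    : ∀ a b → ι (_+_ K a b) ≡ _+_ L (ι a) (ι b)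
    ι-*    : ∀ a b → ι (_*_ K a b) ≡ _*_ L (ι a) (ι b)
    ι-1    : ι (1# K) ≡ 1# L
    ι-inj  : Injective _≡_ _≡_ ι

  liftPoly : Poly K → Poly L
  liftPoly = map ι

{-# OPTIONS --safe #-}

-- Write N x = x ^ ((q ^ n - 1) / (q - 1)) for x in L = F_{q^n}. Its values are fixed by
-- y ↦ y ^ q, hence lie in K = F_q, and on K it is a ↦ a ^ n, a bijection of K because
-- gcd (n, q - 1) = 1. For Φ x = x * η (N x) one has N (Φ x) = G (N x) with G c = c * η c ^ n,
-- and G (a ^ n) = (a * η (a ^ n)) ^ n; so Φ is injective on L iff a ↦ a * η (a ^ n) is
-- injective on K. By finiteness injective means bijective, and η = h, h + 1 give the
-- two halves of completeness.
module Submission where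

open import Defs
open import Data.Nat using (ℕ; _∸_; _≥_; NonZero) renaming (_^_ to _^ℕ_; _/_ to _/ℕ_)
open import Data.Nat.GCD using (gcd)
open import Data.Nat.Primality using (Prime)
open import Data.Product using (∃; ∃₂; _×_)
open import Relation.Binary.PropositionalEquality using (_≡_)
open import Function.Bundles using (_⇔_)

open import Level using (0ℓ)
open import Algebra.Bundles using (CommutativeRing; CommutativeMonoid)
import Algebra.Properties.Ring
import Algebra.Properties.CommutativeSemigroup
import Algebra.Properties.CommutativeMonoid.Sum
import Algebra.Solver.Ring.NaturalCoefficients.Default
open import Data.Nat using (zero; suc; _≤_; z≤n; s≤s)
import Data.Nat as ℕ
import Data.Nat.Properties as ℕₚ
open import Data.Nat.DivMod using (m*n/n≡m)
open import Data.Nat.GCD using (GCD; gcd-GCD; module Bézout)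
open import Data.Nat.Tactic.RingSolver using (solve-∀)
open import Data.Fin using (Fin; zero; suc)
import Data.Fin as Fin
import Data.Fin.Properties as Finₚ
open import Data.Vec.Functional using ([]; _∷_)
import Data.List as List
open import Data.Product using (_,_; proj₁; proj₂)
open import Data.Product.Function.NonDependent.Propositional using (_×-⇔_)
open import Data.Sum using (_⊎_; inj₁; inj₂)
open import Data.Empty using (⊥-elim)
open import Function using (_∘_)
open import Function.Bundles using (_↔_; Inverse; Injection; mk↔ₛ′; mk⇔)
open import Function.Definitions using (Injective; Surjective; Bijective)
open import Function.Properties.Inverse using (↔-sym; ↔-trans; ↔⇒↣)
open import Relation.Binary.Definitions using (DecidableEquality)
open import Relation.Binary.PropositionalEquality
  using (refl; sym; trans; cong; cong₂; subst; _≢_; module ≡-Reasoning)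
open import Relation.Nullary using (¬_; yes; no; contradiction)
open import Relation.Nullary.Decidable using (via-injection)

repunit : ℕ → ℕ → ℕ
repunit q zero    = 0
repunit q (suc n) = suc (q ℕ.* repunit q n)

repunit-suc : ∀ q n → repunit q (suc n) ≡ repunit q n ℕ.+ q ^ℕ n
repunit-suc q zero    = cong suc (ℕₚ.*-zeroʳ q)
repunit-suc q (suc n) = cong suc (trans (cong (q ℕ.*_) (repunit-suc q n)) (ℕₚ.*-distribˡ-+ q _ _))

repunit*[q∸1]+1≡q^n : ∀ p n → repunit (suc p) n ℕ.* p ℕ.+ 1 ≡ suc p ^ℕ n
repunit*[q∸1]+1≡q^n p zero    = refl
repunit*[q∸1]+1≡q^n p (suc n) =
  trans (regroup p (repunit (suc p) n)) (cong (suc p ℕ.*_) (repunit*[q∸1]+1≡q^n p n))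
  where
  regroup : ∀ p r → suc (suc p ℕ.* r) ℕ.* p ℕ.+ 1 ≡ suc p ℕ.* (r ℕ.* p ℕ.+ 1)
  regroup = solve-∀

[q^n∸1]/[q∸1]≡repunit : ∀ p n .{{_ : NonZero p}} → (suc p ^ℕ n ∸ 1) /ℕ p ≡ repunit (suc p) n
[q^n∸1]/[q∸1]≡repunit p n = begin
  (suc p ^ℕ n ∸ 1) /ℕ p                      ≡⟨ cong (λ k → (k ∸ 1) /ℕ p) (repunit*[q∸1]+1≡q^n p n) ⟨
  (repunit (suc p) n ℕ.* p ℕ.+ 1 ∸ 1) /ℕ p   ≡⟨ cong (_/ℕ p) (ℕₚ.m+n∸n≡m _ 1) ⟩
  repunit (suc p) n ℕ.* p /ℕ p               ≡⟨ m*n/n≡m (repunit (suc p) n) p ⟩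
  repunit (suc p) n                          ∎
  where open ≡-Reasoning

module FiniteFieldProperties (F : FiniteField) where

  open FiniteField F

  commutativeRing : CommutativeRing 0ℓ 0ℓ
  commutativeRing = record { isCommutativeRing = isCommutativeRing }

  open CommutativeRing commutativeRing public
    using ( +-identityˡ; +-identityʳ; -‿inverseʳ; *-assoc; *-comm; *-identityˡ; *-identityʳ
          ; zeroˡ; zeroʳ; distribˡ )
  open Algebra.Properties.Ring (CommutativeRing.ring commutativeRing) public
    using (x+x≈x⇒x≈0; x[y-z]≈xy-xz)
  open Algebra.Properties.CommutativeSemigroup
    (CommutativeMonoid.commutativeSemigroup (CommutativeRing.*-commutativeMonoid commutativeRing))
    using (interchange; x∙yz≈y∙xz)
  open Algebra.Properties.CommutativeMonoid.Sum (CommutativeRing.*-commutativeMonoid commutativeRing)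
    using () renaming (sum to ∏; ∑-distrib-+ to ∏-distrib-*; ∑-permute to ∏-permute; sum-cong-≗ to ∏-cong)
  open Algebra.Solver.Ring.NaturalCoefficients.Default (CommutativeRing.commutativeSemiring commutativeRing)
    using (solve; _:+_; _:*_; _:=_)
  open ≡-Reasoning

  element : Fin size → Carrier
  element = Inverse.to enum

  index : Carrier → Fin size
  index = Inverse.from enum

  element-injective : Injective _≡_ _≡_ element
  element-injective = Injection.injective (↔⇒↣ enum)

  index-injective : Injective _≡_ _≡_ index
  index-injective = Injection.injective (↔⇒↣ (↔-sym enum))

  _≟_ : DecidableEquality Carrier
  _≟_ = via-injection (↔⇒↣ (↔-sym enum)) Fin._≟_

  injective⇒≤size : ∀ {m} {r : Fin m → Carrier} → Injective _≡_ _≡_ r → m ≤ size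
  injective⇒≤size r-inj = Finₚ.injective⇒≤ (λ p → r-inj (index-injective p))

  ∈image⊎∷-injective : ∀ {m} (r : Fin m → Carrier) → Injective _≡_ _≡_ r → ∀ y →
                       (∃ λ i → r i ≡ y) ⊎ Injective _≡_ _≡_ (y ∷ r)
  ∈image⊎∷-injective r r-inj y with Finₚ.any? (λ i → r i ≟ y)
  ... | yes y∈r = inj₁ y∈r
  ... | no  y∉r = inj₂ ∷-injective
    where
    ∷-injective : Injective _≡_ _≡_ (y ∷ r)
    ∷-injective {zero}  {zero}  _ = refl
    ∷-injective {zero}  {suc j} p = ⊥-elim (y∉r (j , sym p))
    ∷-injective {suc i} {zero}  p = ⊥-elim (y∉r (i , p))
    ∷-injective {suc i} {suc j} p = cong suc (r-inj p)

  injective⇒bijective : ∀ {f : Carrier → Carrier} → Injective _≡_ _≡_ f → Bijective _≡_ _≡_ f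
  injective⇒bijective {f} f-inj = f-inj , surjective
    where
    surjective : Surjective _≡_ _≡_ f
    surjective y with ∈image⊎∷-injective (f ∘ element) (λ p → element-injective (f-inj p)) y
    ... | inj₁ (i , fi≡y) = element i , λ { refl → fi≡y }
    ... | inj₂ ∷-inj      = contradiction (injective⇒≤size ∷-inj) ℕₚ.1+n≰n

  2≤size : 2 ≤ size
  2≤size = injective⇒≤size {r = 0# ∷ 1# ∷ []} distinct
    where
    distinct : Injective _≡_ _≡_ (0# ∷ 1# ∷ [])
    distinct {zero}     {zero}     _ = refl
    distinct {zero}     {suc zero} p = ⊥-elim (0≢1 p)
    distinct {suc zero} {zero}     p = ⊥-elim (0≢1 (sym p))
    distinct {suc zero} {suc zero} _ = refl

  module _ {x : Carrier} (x≢0 : x ≢ 0#) where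

    private
      x⁻¹ : Carrier
      x⁻¹ = proj₁ (inverse x x≢0)

      x⁻¹*[x*y]≡y : ∀ y → x⁻¹ * (x * y) ≡ y
      x⁻¹*[x*y]≡y y = begin
        x⁻¹ * (x * y)  ≡⟨ *-assoc x⁻¹ x y ⟨
        x⁻¹ * x * y    ≡⟨ cong (_* y) (trans (*-comm x⁻¹ x) (proj₂ (inverse x x≢0))) ⟩
        1# * y         ≡⟨ *-identityˡ y ⟩
        y              ∎

      x*[x⁻¹*y]≡y : ∀ y → x * (x⁻¹ * y) ≡ y
      x*[x⁻¹*y]≡y y = begin
        x * (x⁻¹ * y)  ≡⟨ *-assoc x x⁻¹ y ⟨
        x * x⁻¹ * y    ≡⟨ cong (_* y) (proj₂ (inverse x x≢0)) ⟩
        1# * y         ≡⟨ *-identityˡ y ⟩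
        y              ∎

    *-cancelˡ : ∀ {y z} → x * y ≡ x * z → y ≡ z
    *-cancelˡ {y} {z} xy≡xz = begin
      y              ≡⟨ x⁻¹*[x*y]≡y y ⟨
      x⁻¹ * (x * y)  ≡⟨ cong (x⁻¹ *_) xy≡xz ⟩
      x⁻¹ * (x * z)  ≡⟨ x⁻¹*[x*y]≡y z ⟩
      z              ∎

    *-cancelʳ : ∀ {y z} → y * x ≡ z * x → y ≡ z
    *-cancelʳ {y} {z} yx≡zx = *-cancelˡ (trans (*-comm x y) (trans yx≡zx (*-comm z x)))

    x*-↔ : Carrier ↔ Carrier
    x*-↔ = mk↔ₛ′ (x *_) (x⁻¹ *_) x*[x⁻¹*y]≡y x⁻¹*[x*y]≡y

  *-≢0 : ∀ {x y} → x ≢ 0# → y ≢ 0# → x * y ≢ 0#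
  *-≢0 {x} x≢0 y≢0 xy≡0 = y≢0 (*-cancelˡ x≢0 (trans xy≡0 (sym (zeroʳ x))))

  x*[y+1]≡x*y+x : ∀ x y → x * (y + 1#) ≡ x * y + x
  x*[y+1]≡x*y+x x y = trans (distribˡ x y 1#) (cong (x * y +_) (*-identityʳ x))

  ^-homo-* : ∀ x m n → x ^ (m ℕ.+ n) ≡ x ^ m * x ^ n
  ^-homo-* x zero    n = sym (*-identityˡ _)
  ^-homo-* x (suc m) n = trans (cong (x *_) (^-homo-* x m n)) (sym (*-assoc x _ _))

  ^-assocʳ : ∀ x m n → (x ^ m) ^ n ≡ x ^ (m ℕ.* n)
  ^-assocʳ x m zero    = cong (x ^_) (sym (ℕₚ.*-zeroʳ m))
  ^-assocʳ x m (suc n) = begin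
    x ^ m * (x ^ m) ^ n    ≡⟨ cong (x ^ m *_) (^-assocʳ x m n) ⟩
    x ^ m * x ^ (m ℕ.* n)  ≡⟨ ^-homo-* x m (m ℕ.* n) ⟨
    x ^ (m ℕ.+ m ℕ.* n)    ≡⟨ cong (x ^_) (ℕₚ.*-suc m n) ⟨
    x ^ (m ℕ.* suc n)      ∎

  ^-distrib-* : ∀ x y n → (x * y) ^ n ≡ x ^ n * y ^ n
  ^-distrib-* x y zero    = sym (*-identityˡ 1#)
  ^-distrib-* x y (suc n) = trans (cong (x * y *_) (^-distrib-* x y n)) (interchange x y _ _)

  1^n≡1 : ∀ n → 1# ^ n ≡ 1#
  1^n≡1 zero    = refl
  1^n≡1 (suc n) = trans (*-identityˡ _) (1^n≡1 n)

  0^n≡0 : ∀ n .{{_ : NonZero n}} → 0# ^ n ≡ 0#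
  0^n≡0 (suc n) = zeroˡ _

  ^≡0⇒≡0 : ∀ x n → x ^ n ≡ 0# → x ≡ 0#
  ^≡0⇒≡0 x zero    1≡0 = ⊥-elim (0≢1 (sym 1≡0))
  ^≡0⇒≡0 x (suc n) xⁿ⁺¹≡0 with x ≟ 0#
  ... | yes x≡0 = x≡0
  ... | no  x≢0 = ^≡0⇒≡0 x n (*-cancelˡ x≢0 (trans xⁿ⁺¹≡0 (sym (zeroʳ x))))

  ∏-const : ∀ n x → ∏ {n} (λ _ → x) ≡ x ^ n
  ∏-const zero    x = refl
  ∏-const (suc n) x = cong (x *_) (∏-const n x)

  ∏-≢0 : ∀ {n} (f : Fin n → Carrier) → (∀ i → f i ≢ 0#) → ∏ f ≢ 0#
  ∏-≢0 {zero}  f _   = 0≢1 ∘ sym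
  ∏-≢0 {suc n} f f≢0 = *-≢0 (f≢0 zero) (∏-≢0 (f ∘ suc) (f≢0 ∘ suc))

  ∏-except : ∀ {n} (f g : Fin n → Carrier) i → (∀ j → j ≢ i → f j ≡ g j) →
             f i * ∏ g ≡ g i * ∏ f
  ∏-except f g zero f≡g = begin
    f zero * (g zero * ∏ (g ∘ suc))  ≡⟨ x∙yz≈y∙xz _ _ _ ⟩
    g zero * (f zero * ∏ (g ∘ suc))  ≡⟨ cong (λ p → g zero * (f zero * p)) (∏-cong g∘suc≡f∘suc) ⟩
    g zero * (f zero * ∏ (f ∘ suc))  ∎
    where
    g∘suc≡f∘suc : ∀ j → g (suc j) ≡ f (suc j)
    g∘suc≡f∘suc j = sym (f≡g (suc j) λ ())
  ∏-except f g (suc i) f≡g = begin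
    f (suc i) * (g zero * ∏ (g ∘ suc))  ≡⟨ x∙yz≈y∙xz _ _ _ ⟩
    g zero * (f (suc i) * ∏ (g ∘ suc))  ≡⟨ cong₂ _*_ (sym (f≡g zero λ ()))
                                                      (∏-except (f ∘ suc) (g ∘ suc) i f∘suc≡g∘suc) ⟩
    f zero * (g (suc i) * ∏ (f ∘ suc))  ≡⟨ x∙yz≈y∙xz _ _ _ ⟩
    g (suc i) * (f zero * ∏ (f ∘ suc))  ∎
    where
    f∘suc≡g∘suc : ∀ j → j ≢ i → f (suc j) ≡ g (suc j)
    f∘suc≡g∘suc j j≢i = f≡g (suc j) (j≢i ∘ Finₚ.suc-injective)

  private
    zero↦1 : Carrier → Carrier
    zero↦1 x with x ≟ 0#
    ... | yes _ = 1#
    ... | no  _ = x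

    zero↦1-0 : zero↦1 0# ≡ 1#
    zero↦1-0 with 0# ≟ 0#
    ... | yes _   = refl
    ... | no  0≢0 = ⊥-elim (0≢0 refl)

    zero↦1-≢0 : ∀ {x} → x ≢ 0# → zero↦1 x ≡ x
    zero↦1-≢0 {x} x≢0 with x ≟ 0#
    ... | yes x≡0 = ⊥-elim (x≢0 x≡0)
    ... | no  _   = refl

    zero↦1≢0 : ∀ x → zero↦1 x ≢ 0#
    zero↦1≢0 x with x ≟ 0#
    ... | yes _   = 0≢1 ∘ sym
    ... | no  x≢0 = x≢0

  -- Multiplication by x ≢ 0 permutes the elements, so ∏ zero↦1 (x * e) ≡ ∏ zero↦1 e over
  -- all e; this product and ∏ (x * zero↦1 e) ≡ x ^ size * ∏ zero↦1 e differ only in the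
  -- factor at e = 0, which is 1 resp. x.
  x^size≡x : ∀ x → x ^ size ≡ x
  x^size≡x x with x ≟ 0#
  ... | yes refl = 0^n≡0 size {{ℕ.>-nonZero (ℕₚ.≤-trans (s≤s z≤n) 2≤size)}}
  ... | no  x≢0  = *-cancelʳ (∏-≢0 u (zero↦1≢0 ∘ element)) (begin
    x ^ size * ∏ u             ≡⟨ cong (_* ∏ u) (∏-const size x) ⟨
    ∏ {size} (λ _ → x) * ∏ u   ≡⟨ ∏-distrib-* (λ _ → x) u ⟨
    ∏ xu                       ≡⟨ *-identityˡ (∏ xu) ⟨
    1# * ∏ xu                  ≡⟨ cong (_* ∏ xu) ux₀≡1 ⟨
    ux i₀ * ∏ xu               ≡⟨ ∏-except ux xu i₀ ux≡xu ⟩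
    xu i₀ * ∏ ux               ≡⟨ cong₂ _*_ xu₀≡x ∏ux≡∏u ⟩
    x * ∏ u                    ∎)
    where
    u ux xu : Fin size → Carrier
    u i  = zero↦1 (element i)
    ux i = zero↦1 (x * element i)
    xu i = x * zero↦1 (element i)

    i₀ : Fin size
    i₀ = index 0#

    e₀≡0 : element i₀ ≡ 0#
    e₀≡0 = Inverse.strictlyInverseˡ enum 0#

    ux₀≡1 : ux i₀ ≡ 1#
    ux₀≡1 = trans (cong zero↦1 (trans (cong (x *_) e₀≡0) (zeroʳ x))) zero↦1-0

    xu₀≡x : xu i₀ ≡ x
    xu₀≡x = trans (cong (λ e → x * zero↦1 e) e₀≡0) (trans (cong (x *_) zero↦1-0) (*-identityʳ x))

    ux≡xu : ∀ i → i ≢ i₀ → ux i ≡ xu i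
    ux≡xu i i≢i₀ = trans (zero↦1-≢0 (*-≢0 x≢0 eᵢ≢0)) (cong (x *_) (sym (zero↦1-≢0 eᵢ≢0)))
      where
      eᵢ≢0 : element i ≢ 0#
      eᵢ≢0 eᵢ≡0 = i≢i₀ (trans (sym (Inverse.strictlyInverseʳ enum i)) (cong index eᵢ≡0))

    π : Fin size ↔ Fin size
    π = ↔-trans enum (↔-trans (x*-↔ x≢0) (↔-sym enum))

    ∏ux≡∏u : ∏ ux ≡ ∏ u
    ∏ux≡∏u = trans (∏-cong (λ i → cong zero↦1 (sym (Inverse.strictlyInverseˡ enum (x * element i)))))
                   (sym (∏-permute u π))

  x^[size∸1]≡1 : ∀ {k x} → size ≡ suc k → x ≢ 0# → x ^ k ≡ 1#
  x^[size∸1]≡1 {k} {x} size≡1+k x≢0 = *-cancelˡ x≢0 (begin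
    x ^ suc k  ≡⟨ cong (x ^_) size≡1+k ⟨
    x ^ size   ≡⟨ x^size≡x x ⟩
    x          ≡⟨ *-identityʳ x ⟨
    x * 1#     ∎)

  ^≡1⇒^[i*a]≡1 : ∀ {x} a i → x ^ a ≡ 1# → x ^ (i ℕ.* a) ≡ 1#
  ^≡1⇒^[i*a]≡1     a zero    _    = refl
  ^≡1⇒^[i*a]≡1 {x} a (suc i) xᵃ≡1 = begin
    x ^ (a ℕ.+ i ℕ.* a)      ≡⟨ ^-homo-* x a (i ℕ.* a) ⟩
    x ^ a * x ^ (i ℕ.* a)    ≡⟨ cong₂ _*_ xᵃ≡1 (^≡1⇒^[i*a]≡1 a i xᵃ≡1) ⟩
    1# * 1#                  ≡⟨ *-identityˡ 1# ⟩
    1#                       ∎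

  ^≡1-bézout : ∀ {x} a b i j → x ^ a ≡ 1# → x ^ b ≡ 1# → 1 ℕ.+ i ℕ.* a ≡ j ℕ.* b → x ≡ 1#
  ^≡1-bézout {x} a b i j xᵃ≡1 xᵇ≡1 1+ia≡jb = begin
    x                    ≡⟨ *-identityʳ x ⟨
    x * 1#               ≡⟨ cong (x *_) (^≡1⇒^[i*a]≡1 a i xᵃ≡1) ⟨
    x ^ (1 ℕ.+ i ℕ.* a)  ≡⟨ cong (x ^_) 1+ia≡jb ⟩
    x ^ (j ℕ.* b)        ≡⟨ ^≡1⇒^[i*a]≡1 b j xᵇ≡1 ⟩
    1#                   ∎

  ^≡1-coprime : ∀ {x} m n → x ^ m ≡ 1# → x ^ n ≡ 1# → gcd m n ≡ 1 → x ≡ 1#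
  ^≡1-coprime m n xᵐ≡1 xⁿ≡1 gcd≡1 with Bézout.identity (subst (GCD m n) gcd≡1 (gcd-GCD m n))
  ... | Bézout.+- i j 1+jn≡im = ^≡1-bézout n m j i xⁿ≡1 xᵐ≡1 1+jn≡im
  ... | Bézout.-+ i j 1+im≡jn = ^≡1-bézout m n i j xᵐ≡1 xⁿ≡1 1+im≡jn

  -- For y ≢ 0, x * y⁻¹ is both an n-th and a k-th root of unity, hence 1.
  ^-injective : ∀ {k} n .{{_ : NonZero n}} → size ≡ suc k → gcd n k ≡ 1 →
                Injective _≡_ _≡_ (_^ n)
  ^-injective {k} n size≡1+k coprime {x} {y} xⁿ≡yⁿ with y ≟ 0#
  ... | yes refl = ^≡0⇒≡0 x n (trans xⁿ≡yⁿ (0^n≡0 n))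
  ... | no  y≢0  = begin
    x                ≡⟨ *-identityʳ x ⟨
    x * 1#           ≡⟨ cong (x *_) (trans (*-comm y⁻¹ y) yy⁻¹≡1) ⟨
    x * (y⁻¹ * y)    ≡⟨ *-assoc x y⁻¹ y ⟨
    x * y⁻¹ * y      ≡⟨ cong (_* y) (^≡1-coprime n k cⁿ≡1 (x^[size∸1]≡1 size≡1+k c≢0) coprime) ⟩
    1# * y           ≡⟨ *-identityˡ y ⟩
    y                ∎
    where
    y⁻¹ : Carrier
    y⁻¹ = proj₁ (inverse y y≢0)
    yy⁻¹≡1 : y * y⁻¹ ≡ 1#
    yy⁻¹≡1 = proj₂ (inverse y y≢0)
    cⁿ≡1 : (x * y⁻¹) ^ n ≡ 1#
    cⁿ≡1 = begin
      (x * y⁻¹) ^ n    ≡⟨ ^-distrib-* x y⁻¹ n ⟩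
      x ^ n * y⁻¹ ^ n  ≡⟨ cong (_* y⁻¹ ^ n) xⁿ≡yⁿ ⟩
      y ^ n * y⁻¹ ^ n  ≡⟨ ^-distrib-* y y⁻¹ n ⟨
      (y * y⁻¹) ^ n    ≡⟨ cong (_^ n) yy⁻¹≡1 ⟩
      1# ^ n           ≡⟨ 1^n≡1 n ⟩
      1#               ∎
    c≢0 : x * y⁻¹ ≢ 0#
    c≢0 c≡0 = 0≢1 (trans (sym (0^n≡0 n)) (trans (cong (_^ n) (sym c≡0)) cⁿ≡1))

  ^-repunit : ∀ {q x} → x ^ q ≡ x → ∀ n → x ^ repunit q n ≡ x ^ n
  ^-repunit _ zero = refl
  ^-repunit {q} {x} xᵠ≡x (suc n) = cong (x *_) (begin
    x ^ (q ℕ.* repunit q n)  ≡⟨ ^-assocʳ x q (repunit q n) ⟨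
    (x ^ q) ^ repunit q n    ≡⟨ cong (_^ repunit q n) xᵠ≡x ⟩
    x ^ repunit q n          ≡⟨ ^-repunit xᵠ≡x n ⟩
    x ^ n                    ∎)

  [x^repunit]^q≡x^repunit : ∀ {q x} n .{{_ : NonZero n}} → x ^ (q ^ℕ n) ≡ x →
                            (x ^ repunit q n) ^ q ≡ x ^ repunit q n
  [x^repunit]^q≡x^repunit {q} {x} (suc n) x^qⁿ≡x = begin
    (x ^ repunit q (suc n)) ^ q                 ≡⟨ ^-assocʳ x (repunit q (suc n)) q ⟩
    x ^ (repunit q (suc n) ℕ.* q)               ≡⟨ cong (x ^_) (ℕₚ.*-comm (repunit q (suc n)) q) ⟩
    x ^ (q ℕ.* repunit q (suc n))               ≡⟨ cong (x ^_) (ℕₚ.suc-injective (repunit-suc q (suc n))) ⟩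
    x ^ (q ℕ.* repunit q n ℕ.+ q ^ℕ suc n)      ≡⟨ ^-homo-* x (q ℕ.* repunit q n) (q ^ℕ suc n) ⟩
    x ^ (q ℕ.* repunit q n) * x ^ (q ^ℕ suc n)  ≡⟨ cong (x ^ (q ℕ.* repunit q n) *_) x^qⁿ≡x ⟩
    x ^ (q ℕ.* repunit q n) * x                 ≡⟨ *-comm _ x ⟩
    x ^ repunit q (suc n)                       ∎

  -- Monic polynomial functions of degree d, given pointwise by Horner steps.
  data Monic : ℕ → (Carrier → Carrier) → Set where
    monic-one  : ∀ {f} → (∀ x → f x ≡ 1#) → Monic 0 f
    monic-step : ∀ {d f g} c → Monic d g → (∀ x → f x ≡ x * g x + c) → Monic (suc d) f

  -- The factor theorem f x ≡ (x - r) * g x + f r, with the subtraction moved across.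
  monic-factor : ∀ {d f} → Monic (suc d) f → ∀ r →
                 ∃ λ g → Monic d g × (∀ x → f x + r * g x ≡ x * g x + f r)
  monic-factor {f = f} (monic-step {g = g} c (monic-one g≡1) f≡) r =
    g , monic-one g≡1 , λ x → begin
      f x + r * g x            ≡⟨ cong₂ _+_ (f≡ x) (cong (r *_) (trans (g≡1 x) (sym (g≡1 r)))) ⟩
      x * g x + c + r * g r    ≡⟨ regroup (x * g x) (r * g r) c ⟩
      x * g x + (r * g r + c)  ≡⟨ cong (x * g x +_) (f≡ r) ⟨
      x * g x + f r            ∎
    where
    regroup : ∀ a b c → a + c + b ≡ a + (b + c)
    regroup = solve 3 (λ a b c → a :+ c :+ b := a :+ (b :+ c)) refl
  monic-factor {f = f} (monic-step {g = g} c mg@(monic-step _ _ _) f≡) r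
    with monic-factor mg r
  ... | g′ , mg′ , g≡ = (λ x → x * g′ x + g r) , monic-step (g r) mg′ (λ _ → refl) , λ x → begin
      f x + r * (x * g′ x + g r)            ≡⟨ cong (_+ r * (x * g′ x + g r)) (f≡ x) ⟩
      x * g x + c + r * (x * g′ x + g r)    ≡⟨ regroup x r (g x) (g′ x) (g r) c ⟩
      x * (g x + r * g′ x) + (r * g r + c)  ≡⟨ cong₂ (λ a b → x * a + b) (g≡ x) (sym (f≡ r)) ⟩
      x * (x * g′ x + g r) + f r            ∎
    where
    regroup : ∀ x r g g′ gr c → x * g + c + r * (x * g′ + gr) ≡ x * (g + r * g′) + (r * gr + c)
    regroup = solve 6 (λ x r g g′ gr c →
      x :* g :+ c :+ r :* (x :* g′ :+ gr) := x :* (g :+ r :* g′) :+ (r :* gr :+ c)) refl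

  monic-roots≤degree : ∀ {d f m} → Monic d f → (r : Fin m → Carrier) → Injective _≡_ _≡_ r →
                       (∀ i → f (r i) ≡ 0#) → m ≤ d
  monic-roots≤degree {m = zero} _ _ _ _ = z≤n
  monic-roots≤degree {m = suc m} (monic-one f≡1) r _ roots =
    ⊥-elim (0≢1 (trans (sym (roots zero)) (f≡1 (r zero))))
  monic-roots≤degree {f = f} {m = suc m} mf@(monic-step _ _ _) r r-inj roots
    with monic-factor mf (r zero)
  ... | g , mg , f≡ = s≤s (monic-roots≤degree mg (r ∘ suc) (λ p → Finₚ.suc-injective (r-inj p)) g-roots)
    where
    g-roots : ∀ i → g (r (suc i)) ≡ 0#
    g-roots i with g (r (suc i)) ≟ 0#
    ... | yes g≡0 = g≡0
    ... | no  g≢0 = contradiction (r-inj (*-cancelʳ g≢0 r₀g≡rᵢg)) λ ()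
      where
      r₀g≡rᵢg : r zero * g (r (suc i)) ≡ r (suc i) * g (r (suc i))
      r₀g≡rᵢg = begin
        r zero * g (r (suc i))                  ≡⟨ +-identityˡ _ ⟨
        0# + r zero * g (r (suc i))             ≡⟨ cong (_+ _) (roots (suc i)) ⟨
        f (r (suc i)) + r zero * g (r (suc i))  ≡⟨ f≡ (r (suc i)) ⟩
        r (suc i) * g (r (suc i)) + f (r zero)  ≡⟨ cong (_ +_) (roots zero) ⟩
        r (suc i) * g (r (suc i)) + 0#          ≡⟨ +-identityʳ _ ⟩
        r (suc i) * g (r (suc i))               ∎

  monic-^ : ∀ k → Monic k (_^ k)
  monic-^ zero    = monic-one (λ _ → refl)
  monic-^ (suc k) = monic-step 0# (monic-^ k) (λ x → sym (+-identityʳ _))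

  monic-^-id : ∀ k → Monic (suc (suc k)) (λ x → x ^ suc (suc k) + - x)
  monic-^-id k = monic-step 0# (monic-step (- 1#) (monic-^ k) (λ _ → refl)) λ x → begin
    x ^ suc (suc k) + - x        ≡⟨ cong (λ y → x ^ suc (suc k) + - y) (*-identityʳ x) ⟨
    x * x ^ suc k + - (x * 1#)   ≡⟨ x[y-z]≈xy-xz x (x ^ suc k) 1# ⟨
    x * (x ^ suc k + - 1#)       ≡⟨ +-identityʳ _ ⟨
    x * (x ^ suc k + - 1#) + 0#  ∎

module FieldEmbeddingProperties {K L : FiniteField} (E : FieldEmbedding K L) where

  private
    module K  = FiniteField K
    module L  = FiniteField L
    module Kₚ = FiniteFieldProperties K
    module Lₚ = FiniteFieldProperties L

  open FieldEmbedding E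
  open ≡-Reasoning

  ι-0 : ι K.0# ≡ L.0#
  ι-0 = Lₚ.x+x≈x⇒x≈0 (ι K.0#) (trans (sym (ι-+ K.0# K.0#)) (cong ι (Kₚ.+-identityʳ K.0#)))

  ι-^ : ∀ a n → ι (a K.^ n) ≡ ι a L.^ n
  ι-^ a zero    = ι-1
  ι-^ a (suc n) = trans (ι-* a _) (cong (ι a L.*_) (ι-^ a n))

  ι-eval : ∀ p a → ι (K.eval p a) ≡ L.eval (liftPoly p) (ι a)
  ι-eval List.[]      a = ι-0
  ι-eval (c List.∷ p) a = begin
    ι (c K.+ a K.* K.eval p a)                    ≡⟨ ι-+ c _ ⟩
    ι c L.+ ι (a K.* K.eval p a)                  ≡⟨ cong (ι c L.+_) (ι-* a _) ⟩
    ι c L.+ ι a L.* ι (K.eval p a)                ≡⟨ cong (λ v → ι c L.+ ι a L.* v) (ι-eval p a) ⟩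
    ι c L.+ ι a L.* L.eval (liftPoly p) (ι a)     ∎

  ι≡0⇒≡0 : ∀ {a} → ι a ≡ L.0# → a ≡ K.0#
  ι≡0⇒≡0 ιa≡0 = ι-inj (trans ιa≡0 (sym ι-0))

  private
    ι∘element : Fin K.size → L.Carrier
    ι∘element = ι ∘ Kₚ.element

    ι∘element-injective : Injective _≡_ _≡_ ι∘element
    ι∘element-injective p = Kₚ.element-injective (ι-inj p)

  -- y and the elements of ι K would be |K| + 1 distinct roots of X ^ |K| - X.
  ^|K|≡id⇒∈image : ∀ {k} → K.size ≡ suc (suc k) → ∀ y → y L.^ suc (suc k) ≡ y → ∃ λ a → ι a ≡ y
  ^|K|≡id⇒∈image {k} |K|≡2+k y yᵠ≡y with Lₚ.∈image⊎∷-injective ι∘element ι∘element-injective y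
  ... | inj₁ (i , ιeᵢ≡y) = Kₚ.element i , ιeᵢ≡y
  ... | inj₂ ∷-inj = contradiction
    (Lₚ.monic-roots≤degree (Lₚ.monic-^-id k) (y ∷ ι∘element) ∷-inj roots)
    (subst (λ s → ¬ suc s ≤ suc (suc k)) (sym |K|≡2+k) ℕₚ.1+n≰n)
    where
    root : ∀ {z} → z L.^ suc (suc k) ≡ z → z L.^ suc (suc k) L.+ L.- z ≡ L.0#
    root {z} zᵠ≡z = trans (cong (L._+ L.- z) zᵠ≡z) (Lₚ.-‿inverseʳ z)

    ι[a]ᵠ≡ι[a] : ∀ a → ι a L.^ suc (suc k) ≡ ι a
    ι[a]ᵠ≡ι[a] a = begin
      ι a L.^ suc (suc k)   ≡⟨ ι-^ a (suc (suc k)) ⟨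
      ι (a K.^ suc (suc k)) ≡⟨ cong (λ e → ι (a K.^ e)) |K|≡2+k ⟨
      ι (a K.^ K.size)      ≡⟨ cong ι (Kₚ.x^size≡x a) ⟩
      ι a                   ∎

    roots : ∀ i → (y ∷ ι∘element) i L.^ suc (suc k) L.+ L.- (y ∷ ι∘element) i ≡ L.0#
    roots zero    = root yᵠ≡y
    roots (suc i) = root (ι[a]ᵠ≡ι[a] (Kₚ.element i))

module NormTransfer {K L : FiniteField} (E : FieldEmbedding K L) (m n : ℕ) .{{_ : NonZero n}}
  (|K|≡q : FiniteField.size K ≡ suc (suc m)) (|L|≡qⁿ : FiniteField.size L ≡ suc (suc m) ^ℕ n)
  (coprime : gcd n (suc m) ≡ 1) where

  private
    module K  = FiniteField K
    module L  = FiniteField L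
    module Kₚ = FiniteFieldProperties K
    module Lₚ = FiniteFieldProperties L

  open FieldEmbedding E
  open FieldEmbeddingProperties E
  open ≡-Reasoning

  N : ℕ
  N = (suc (suc m) ^ℕ n ∸ 1) /ℕ suc m

  N≡repunit : N ≡ repunit (suc (suc m)) n
  N≡repunit = [q^n∸1]/[q∸1]≡repunit (suc m) n

  ι-^N : ∀ a → ι a L.^ N ≡ ι (a K.^ n)
  ι-^N a = begin
    ι a L.^ N                          ≡⟨ cong (ι a L.^_) N≡repunit ⟩
    ι a L.^ repunit (suc (suc m)) n    ≡⟨ ι-^ a (repunit (suc (suc m)) n) ⟨
    ι (a K.^ repunit (suc (suc m)) n)  ≡⟨ cong ι (Kₚ.^-repunit aᵠ≡a n) ⟩
    ι (a K.^ n)                        ∎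
    where
    aᵠ≡a : a K.^ suc (suc m) ≡ a
    aᵠ≡a = trans (cong (a K.^_) (sym |K|≡q)) (Kₚ.x^size≡x a)

  ^N∈image : ∀ x → ∃ λ c → ι c ≡ x L.^ N
  ^N∈image x = ^|K|≡id⇒∈image |K|≡q (x L.^ N)
    (subst (λ e → (x L.^ e) L.^ suc (suc m) ≡ x L.^ e) (sym N≡repunit)
           (Lₚ.[x^repunit]^q≡x^repunit n x^qⁿ≡x))
    where
    x^qⁿ≡x : x L.^ (suc (suc m) ^ℕ n) ≡ x
    x^qⁿ≡x = trans (cong (x L.^_) (sym |L|≡qⁿ)) (Lₚ.x^size≡x x)

  ^n-injective : Injective _≡_ _≡_ (K._^ n)
  ^n-injective = Kₚ.^-injective n |K|≡q coprime

  ^n-root : ∀ c → ∃ λ v → v K.^ n ≡ c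
  ^n-root c with proj₂ (Kₚ.injective⇒bijective ^n-injective) c
  ... | v , vⁿ≡c = v , vⁿ≡c refl

  module _ (η : K.Carrier → K.Carrier) {Φ : L.Carrier → L.Carrier} {F : K.Carrier → K.Carrier}
           (Φ-def : ∀ x c → ι c ≡ x L.^ N → Φ x ≡ x L.* ι (η c))
           (F-def : ∀ a → F a ≡ a K.* η (a K.^ n)) where

    private
      G : K.Carrier → K.Carrier
      G c = c K.* η c K.^ n

      Φ∘ι≡ι∘F : ∀ a → Φ (ι a) ≡ ι (F a)
      Φ∘ι≡ι∘F a = begin
        Φ (ι a)                   ≡⟨ Φ-def (ι a) (a K.^ n) (sym (ι-^N a)) ⟩
        ι a L.* ι (η (a K.^ n))   ≡⟨ ι-* a _ ⟨
        ι (a K.* η (a K.^ n))     ≡⟨ cong ι (F-def a) ⟨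
        ι (F a)                   ∎

      G[vⁿ]≡F[v]ⁿ : ∀ v → G (v K.^ n) ≡ F v K.^ n
      G[vⁿ]≡F[v]ⁿ v = trans (sym (Kₚ.^-distrib-* v _ n)) (cong (K._^ n) (sym (F-def v)))

      [Φx]^N≡ιGc : ∀ x c → ι c ≡ x L.^ N → Φ x L.^ N ≡ ι (G c)
      [Φx]^N≡ιGc x c ιc≡xᴺ = begin
        Φ x L.^ N                  ≡⟨ cong (L._^ N) (Φ-def x c ιc≡xᴺ) ⟩
        (x L.* ι (η c)) L.^ N      ≡⟨ Lₚ.^-distrib-* x (ι (η c)) N ⟩
        x L.^ N L.* ι (η c) L.^ N  ≡⟨ cong₂ L._*_ (sym ιc≡xᴺ) (ι-^N (η c)) ⟩
        ι c L.* ι (η c K.^ n)      ≡⟨ ι-* c _ ⟨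
        ι (G c)                    ∎

    Φ-injective⇒F-injective : Injective _≡_ _≡_ Φ → Injective _≡_ _≡_ F
    Φ-injective⇒F-injective Φ-inj {a} {b} Fa≡Fb =
      ι-inj (Φ-inj (trans (Φ∘ι≡ι∘F a) (trans (cong ι Fa≡Fb) (sym (Φ∘ι≡ι∘F b)))))

    module _ (F-inj : Injective _≡_ _≡_ F) where

      private
        G-injective : Injective _≡_ _≡_ G
        G-injective {c} {c′} Gc≡Gc′ with ^n-root c | ^n-root c′
        ... | v , refl | v′ , refl = cong (K._^ n) (F-inj (^n-injective (begin
          F v K.^ n     ≡⟨ G[vⁿ]≡F[v]ⁿ v ⟨
          G (v K.^ n)   ≡⟨ Gc≡Gc′ ⟩
          G (v′ K.^ n)  ≡⟨ G[vⁿ]≡F[v]ⁿ v′ ⟩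
          F v′ K.^ n    ∎)))

        norm-injective : ∀ {y z c c′} → ι c ≡ y L.^ N → ι c′ ≡ z L.^ N → Φ y ≡ Φ z → c ≡ c′
        norm-injective {y} {z} {c} {c′} ιc≡yᴺ ιc′≡zᴺ Φy≡Φz = G-injective (ι-inj (begin
          ι (G c)    ≡⟨ [Φx]^N≡ιGc y c ιc≡yᴺ ⟨
          Φ y L.^ N  ≡⟨ cong (L._^ N) Φy≡Φz ⟩
          Φ z L.^ N  ≡⟨ [Φx]^N≡ιGc z c′ ιc′≡zᴺ ⟩
          ι (G c′)   ∎))

        η≡0⇒≡0 : ∀ {c} → η c ≡ K.0# → c ≡ K.0#
        η≡0⇒≡0 {c} ηc≡0 = G-injective (begin
          c K.* η c K.^ n   ≡⟨ cong (λ e → c K.* e K.^ n) ηc≡0 ⟩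
          c K.* K.0# K.^ n  ≡⟨ cong (c K.*_) (Kₚ.0^n≡0 n) ⟩
          c K.* K.0#        ≡⟨ Kₚ.zeroʳ c ⟩
          K.0#              ≡⟨ Kₚ.zeroˡ _ ⟨
          G K.0#            ∎)

      -- Φ y ≡ Φ z forces y and z to have the same norm c, and then Φ multiplies both by
      -- ι (η c); this factor vanishes only when c ≡ 0, that is y ≡ z ≡ 0.
      F-injective⇒Φ-injective : Injective _≡_ _≡_ Φ
      F-injective⇒Φ-injective {y} {z} Φy≡Φz with ^N∈image y | ^N∈image z
      ... | c , ιc≡yᴺ | c′ , ιc′≡zᴺ with norm-injective ιc≡yᴺ ιc′≡zᴺ Φy≡Φz
      ... | refl with η c Kₚ.≟ K.0#
      ...   | no ηc≢0 = Lₚ.*-cancelʳ (ηc≢0 ∘ ι≡0⇒≡0) (begin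
        y L.* ι (η c)  ≡⟨ Φ-def y c ιc≡yᴺ ⟨
        Φ y            ≡⟨ Φy≡Φz ⟩
        Φ z            ≡⟨ Φ-def z c ιc′≡zᴺ ⟩
        z L.* ι (η c)  ∎)
      ...   | yes ηc≡0 = trans (≡0 y ιc≡yᴺ) (sym (≡0 z ιc′≡zᴺ))
        where
        ≡0 : ∀ x → ι c ≡ x L.^ N → x ≡ L.0#
        ≡0 x ιc≡xᴺ = Lₚ.^≡0⇒≡0 x N (trans (sym ιc≡xᴺ) (trans (cong ι (η≡0⇒≡0 ηc≡0)) ι-0))

    permutation-transfer : IsPermutation L Φ ⇔ IsPermutation K F
    permutation-transfer = mk⇔
      (λ (Φ-inj , _) → Kₚ.injective⇒bijective (Φ-injective⇒F-injective Φ-inj))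
      (λ (F-inj , _) → Lₚ.injective⇒bijective (F-injective⇒Φ-injective F-inj))

  complete-permutation-transfer : (h : K.Poly) →
    IsCompletePermutation L (λ x → x L.* L.eval (liftPoly h) (x L.^ N))
      ⇔ IsCompletePermutation K (λ a → a K.* K.eval h (a K.^ n))
  complete-permutation-transfer h =
    permutation-transfer (K.eval h) xh-def (λ _ → refl)
      ×-⇔ permutation-transfer (λ c → K.eval h c K.+ K.1#) xh+x-def
                               (λ a → sym (Kₚ.x*[y+1]≡x*y+x a _))
    where
    xh-def : ∀ x c → ι c ≡ x L.^ N → x L.* L.eval (liftPoly h) (x L.^ N) ≡ x L.* ι (K.eval h c)
    xh-def x c ιc≡xᴺ = cong (x L.*_) (trans (cong (L.eval (liftPoly h)) (sym ιc≡xᴺ)) (sym (ι-eval h c)))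

    xh+x-def : ∀ x c → ι c ≡ x L.^ N →
               x L.* L.eval (liftPoly h) (x L.^ N) L.+ x ≡ x L.* ι (K.eval h c K.+ K.1#)
    xh+x-def x c ιc≡xᴺ = begin
      x L.* L.eval (liftPoly h) (x L.^ N) L.+ x  ≡⟨ cong (L._+ x) (xh-def x c ιc≡xᴺ) ⟩
      x L.* ι (K.eval h c) L.+ x                 ≡⟨ Lₚ.x*[y+1]≡x*y+x x _ ⟨
      x L.* (ι (K.eval h c) L.+ L.1#)            ≡⟨ cong (λ e → x L.* (ι (K.eval h c) L.+ e)) ι-1 ⟨
      x L.* (ι (K.eval h c) L.+ ι K.1#)          ≡⟨ cong (x L.*_) (ι-+ _ _) ⟨
      x L.* ι (K.eval h c K.+ K.1#)              ∎

theorem1 : (q n : ℕ) → .{{_ : NonZero (q ∸ 1)}}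
    → (∃₂ λ p k → Prime p × k ≥ 1 × q ≡ p ^ℕ k)
    → n ≥ 1 → gcd n (q ∸ 1) ≡ 1
    → (K L : FiniteField) → FiniteField.size K ≡ q → FiniteField.size L ≡ q ^ℕ n
    → (E : FieldEmbedding K L) → (h : FiniteField.Poly K)
    → IsCompletePermutation L
        (λ x → FiniteField._*_ L x
          (FiniteField.eval L (FieldEmbedding.liftPoly E h)
            (FiniteField._^_ L x ((q ^ℕ n ∸ 1) /ℕ (q ∸ 1)))))
      ⇔ IsCompletePermutation K
        (λ x → FiniteField._*_ K x (FiniteField.eval K h (FiniteField._^_ K x n)))
theorem1 q zero _ () _ K L _ _ E h
theorem1 q (suc n) _ _ coprime K L |K|≡q |L|≡qⁿ E h
  with subst (2 ≤_) |K|≡q (FiniteFieldProperties.2≤size K)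
... | s≤s (s≤s {n = m} _) = complete-permutation-transfer h
  where open NormTransfer E m (suc n) |K|≡q |L|≡qⁿ coprime
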